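{- Let $G$ be a cubic planar graph and let $H$ be the corresponding auxiliary graph (defined in the context). If $H$ has a coloured orientation, then it has a good coloured orientation.
   Context: The auxiliary graph $H$ is obtained from $G$ by replacing every edge $uv$ of $G$ by the following gadget (an auxiliary edge): new vertices $x,y,z,w,\mathrm{in},\mathrm{out}$ with edges $ux,xy,xz,yw,zw,wv,y\,\mathrm{in},z\,\mathrm{out}$; the vertex $\mathrm{in}$ is the invertex and $\mathrm{out}$ the outvertex. A coloured orientation of $H$ is a colouring of its vertices with black and white together with an orientation of some of its edges such that: every vertex is adjacent to at most one vertex of the opposite colour; an edge is oriented if and only if it is monochromatic (both ends of the same colour); every vertex except the outvertices has outdegree at most two and indegree at most one (unoriented edges not counted); every outvertex has indegree zero. A coloured orientation is good if every vertex of degree three is adjacent to precisely one vertex of the opposite colour and has indegree one and outdegree one. -}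

module Defs where

open import Data.Nat using (ℕ; zero; suc; _+_; _*_; _≤_)
open import Data.Bool using (Bool; true; false; _∧_; _∨_; not; _xor_; if_then_else_)
open import Data.Fin using (Fin)
open import Data.Fin.Properties using () renaming (_≟_ to _≟F_)
open import Data.Product using (Σ; _×_; _,_; proj₁; proj₂; ∃; ∃₂)
open import Data.Sum using (_⊎_; inj₁; inj₂)
open import Data.List using (List; []; _∷_; allFin; cartesianProduct)
open import Relation.Nullary using (¬_)
open import Relation.Nullary.Decidable using (⌊_⌋)
open import Relation.Binary.PropositionalEquality using (_≡_; _≢_)

countL : {A : Set} → (A → Bool) → List A → ℕ
countL p []       = 0
countL p (x ∷ xs) = (if p x then 1 else 0) + countL p xs

anyL : {A : Set} → (A → Bool) → List A → Bool
anyL p []       = false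
anyL p (x ∷ xs) = p x ∨ anyL p xs

-- number of classes of an equivalence relation R (given as a Boolean
-- test) among the elements of a list: count the elements not related
-- to any earlier element.
countReps : {A : Set} → (A → A → Bool) → List A → ℕ
countReps {A} R = go []
  where
  go : List A → List A → ℕ
  go seen []       = 0
  go seen (x ∷ xs) = (if anyL (λ y → R y x) seen then 0 else 1) + go (x ∷ seen) xs

iter : {A : Set} → ℕ → (A → A) → A → A
iter zero    f x = x
iter (suc k) f x = iter k f (f x)

_=F_ : ∀ {n} → Fin n → Fin n → Bool
a =F b = ⌊ a ≟F b ⌋

_=B_ : Bool → Bool → Bool
a =B b = not (a xor b)

record Graph : Set where
  field
    nV   : ℕ
    nE   : ℕ
    ends : Fin nE → Fin nV × Fin nV

open Graph public

SameEnds : ∀ {n} → Fin n × Fin n → Fin n × Fin n → Set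
SameEnds (u , v) (u' , v') = (u ≡ u' × v ≡ v') ⊎ (u ≡ v' × v ≡ u')

Simple : Graph → Set
Simple G = (∀ e → proj₁ (ends G e) ≢ proj₂ (ends G e))
         × (∀ e e' → e ≢ e' → ¬ SameEnds (ends G e) (ends G e'))

degG : (G : Graph) → Fin (nV G) → ℕ
degG G v = countL (λ e → (proj₁ (ends G e) =F v) ∨ (proj₂ (ends G e) =F v)) (allFin (nE G))

Cubic : Graph → Set
Cubic G = ∀ v → degG G v ≡ 3

-- Planarity (combinatorial): G is planar iff it has a rotation system
-- (combinatorial embedding) of genus 0, i.e. satisfying Euler's formula
-- V - E + F = 2C, F = number of faces, C = number of components.

Dart : Graph → Set
Dart G = Fin (nE G) × Bool

darts : (G : Graph) → List (Dart G)
darts G = cartesianProduct (allFin (nE G)) (true ∷ false ∷ [])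

dartVertex : (G : Graph) → Dart G → Fin (nV G)
dartVertex G (e , false) = proj₁ (ends G e)
dartVertex G (e , true)  = proj₂ (ends G e)

opp : ∀ {m} → Fin m × Bool → Fin m × Bool
opp (e , b) = (e , not b)

_=D_ : ∀ {m} → Fin m × Bool → Fin m × Bool → Bool
(e , b) =D (e' , b') = (e =F e') ∧ (b =B b')

record RotationSystem (G : Graph) : Set where
  field
    σ      : Dart G → Dart G
    σ⁻¹    : Dart G → Dart G
    σσ⁻¹   : ∀ d → σ (σ⁻¹ d) ≡ d
    σ⁻¹σ   : ∀ d → σ⁻¹ (σ d) ≡ d
    σ-vert : ∀ d → dartVertex G (σ d) ≡ dartVertex G d
    σ-cyc  : ∀ d d' → dartVertex G d ≡ dartVertex G d' → ∃ λ k → iter k σ d ≡ d'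

module _ {G : Graph} (ρ : RotationSystem G) where
  open RotationSystem ρ

  φ : Dart G → Dart G
  φ d = σ (opp d)

  faceReach : ℕ → Dart G → Dart G → Bool
  faceReach zero    d d' = d =D d'
  faceReach (suc k) d d' = (d =D d') ∨ faceReach k (φ d) d'

  compReach : ℕ → Dart G → Dart G → Bool
  compReach zero    d d' = d =D d'
  compReach (suc k) d d' = (d =D d') ∨ compReach k (σ d) d' ∨ compReach k (opp d) d'

  isolated : ℕ
  isolated = countL (λ v → degG G v Data.Nat.≡ᵇ 0) (allFin (nV G))

  -- isolated vertices count as one face and one component each
  numFaces : ℕ
  numFaces = countReps (faceReach (2 * nE G)) (darts G) + isolated

  numComponents : ℕ
  numComponents = countReps (compReach (2 * nE G)) (darts G) + isolated

Planar : Graph → Set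
Planar G = Σ (RotationSystem G) λ ρ → nV G + numFaces ρ ≡ nE G + 2 * numComponents ρ

data GV : Set where
  gx gy gz gw gin gout : GV

data GE : Set where
  eux exy exz eyw ezw ewv eyin ezout : GE

allGE : List GE
allGE = eux ∷ exy ∷ exz ∷ eyw ∷ ezw ∷ ewv ∷ eyin ∷ ezout ∷ []

_=G_ : GV → GV → Bool
gx   =G gx   = true
gy   =G gy   = true
gz   =G gz   = true
gw   =G gw   = true
gin  =G gin  = true
gout =G gout = true
_    =G _    = false

VH : Graph → Set
VH G = Fin (nV G) ⊎ (Fin (nE G) × GV)

EH : Graph → Set
EH G = Fin (nE G) × GE

edgesH : (G : Graph) → List (EH G)
edgesH G = cartesianProduct (allFin (nE G)) allGE

_=V_ : ∀ {n m} → Fin n ⊎ (Fin m × GV) → Fin n ⊎ (Fin m × GV) → Bool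
inj₁ a       =V inj₁ b       = a =F b
inj₂ (e , g) =V inj₂ (f , h) = (e =F f) ∧ (g =G h)
_            =V _            = false

endsH : (G : Graph) → EH G → VH G × VH G
endsH G (e , eux)   = inj₁ (proj₁ (ends G e)) , inj₂ (e , gx)
endsH G (e , exy)   = inj₂ (e , gx) , inj₂ (e , gy)
endsH G (e , exz)   = inj₂ (e , gx) , inj₂ (e , gz)
endsH G (e , eyw)   = inj₂ (e , gy) , inj₂ (e , gw)
endsH G (e , ezw)   = inj₂ (e , gz) , inj₂ (e , gw)
endsH G (e , ewv)   = inj₂ (e , gw) , inj₁ (proj₂ (ends G e))
endsH G (e , eyin)  = inj₂ (e , gy) , inj₂ (e , gin)
endsH G (e , ezout) = inj₂ (e , gz) , inj₂ (e , gout)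

Outvertex : (G : Graph) → VH G → Set
Outvertex G v = ∃ λ (e : Fin (nE G)) → v ≡ inj₂ (e , gout)

degH : (G : Graph) → VH G → ℕ
degH G v = countL (λ e → (proj₁ (endsH G e) =V v) ∨ (proj₂ (endsH G e) =V v)) (edgesH G)

-- colour: true = black, false = white
Colouring : Graph → Set
Colouring G = VH G → Bool

-- state of an edge (a , b) of H: unoriented, oriented a → b, or b → a
data Ori : Set where
  unor fwd bwd : Ori

Orientation : Graph → Set
Orientation G = EH G → Ori

oppDeg : (G : Graph) → Colouring G → VH G → ℕ
oppDeg G c v = countL (λ e → ((proj₁ (endsH G e) =V v) ∧ (c (proj₂ (endsH G e)) xor c v))
                           ∨ ((proj₂ (endsH G e) =V v) ∧ (c (proj₁ (endsH G e)) xor c v)))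
                      (edgesH G)

isTail : (G : Graph) → Ori → VH G × VH G → VH G → Bool
isTail G unor _       v = false
isTail G fwd  (a , b) v = a =V v
isTail G bwd  (a , b) v = b =V v

isHead : (G : Graph) → Ori → VH G × VH G → VH G → Bool
isHead G unor _       v = false
isHead G fwd  (a , b) v = b =V v
isHead G bwd  (a , b) v = a =V v

outDeg : (G : Graph) → Orientation G → VH G → ℕ
outDeg G o v = countL (λ e → isTail G (o e) (endsH G e) v) (edgesH G)

inDeg : (G : Graph) → Orientation G → VH G → ℕ
inDeg G o v = countL (λ e → isHead G (o e) (endsH G e) v) (edgesH G)

record ColouredOrientation (G : Graph) (c : Colouring G) (o : Orientation G) : Set where
  field
    atMostOneOpposite : ∀ v → oppDeg G c v ≤ 1
    orientedIfMono    : ∀ e → c (proj₁ (endsH G e)) ≡ c (proj₂ (endsH G e)) → o e ≢ unor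
    monoIfOriented    : ∀ e → o e ≢ unor → c (proj₁ (endsH G e)) ≡ c (proj₂ (endsH G e))
    outBound          : ∀ v → ¬ Outvertex G v → outDeg G o v ≤ 2
    inBound           : ∀ v → ¬ Outvertex G v → inDeg G o v ≤ 1
    outvertexIn       : ∀ v → Outvertex G v → inDeg G o v ≡ 0

record GoodColouredOrientation (G : Graph) (c : Colouring G) (o : Orientation G) : Set where
  field
    coloured : ColouredOrientation G c o
    deg3     : ∀ v → degH G v ≡ 3 → oppDeg G c v ≡ 1 × inDeg G o v ≡ 1 × outDeg G o v ≡ 1

module Submission where

-- Lemma 11: if the auxiliary graph H of a simple cubic graph G has a
-- coloured orientation, then it has a good one.
--
-- Every edge uv of G becomes a gadget u-x-{y,z}-w-v with pendant vertices
-- in, out.  An exhaustive check of all coloured orientations of one gadget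
-- (gadgetLemma) shows: (1) the end edges ux, wv carry at least as many arcs
-- into u, v as out of u, v; (2) if the numbers agree, the end edges and the
-- colours of u, v, x, w form one of three balanced patterns.  An original
-- vertex v has degree 3 and each of its edges is bichromatic, incoming or
-- outgoing, so opp + in + out = 3 with opp, in ≤ 1 and in ≤ 1 ≤ out.
-- Summing over V(G), (1) gives  Σ out ≤ Σ in ≤ |V(G)| ≤ Σ out,  so every
-- original vertex is good and, by (2), every gadget is balanced.  Finally
-- the inside of each balanced gadget is replaced by a fixed good pattern
-- (repairLemma), leaving the original vertices untouched.

open import Defs
open import Data.Bool using (Bool; true; false; _∧_; _∨_; not; _xor_; if_then_else_; T)
open import Data.Bool.Properties using (∧-zeroʳ) renaming (_≟_ to _≟B_)
open import Data.Empty using (⊥-elim)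
open import Data.Fin using (Fin) renaming (zero to fzero; suc to fsuc)
open import Data.Fin.Properties using () renaming (_≟_ to _≟F_; suc-injective to fsuc-injective)
open import Data.List using (List; []; _∷_; _++_; map; tabulate; cartesianProduct)
open import Data.Nat using (ℕ; zero; suc; _+_; _≤_; _≤?_; z≤n; s≤s)
open import Data.Nat.Properties
  using (+-0-commutativeMonoid; +-assoc; +-identityʳ; +-mono-≤; +-monoʳ-≤; +-monoˡ-≤;
         +-cancelˡ-≤; +-cancelʳ-≤; ≤-reflexive; ≤-trans; ≤-antisym; suc-injective)
  renaming (_≟_ to _≟ℕ_)
open import Data.Nat.Solver using (module +-*-Solver)
open import Data.Product using (∃₂; _×_; _,_; proj₁; proj₂)
open import Data.Sum using (inj₁; inj₂)
open import Data.Unit using (tt)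
open import Function using (_∘_)
open import Relation.Nullary using (Dec; yes; no; ¬_)
open import Relation.Nullary.Decidable using (_×-dec_; _→-dec_; ¬?; map′; toWitness; T?; dec-true; dec-false; isYes≗does)
open import Relation.Binary.PropositionalEquality
open import Algebra.Properties.CommutativeMonoid.Sum +-0-commutativeMonoid
  using (sum; sum-cong-≗; sum-replicate-zero; ∑-distrib-+; ∑-comm)

val : Bool → ℕ
val b = if b then 1 else 0

countL-cong : {A : Set} {p q : A → Bool} (xs : List A) → (∀ x → p x ≡ q x) →
              countL p xs ≡ countL q xs
countL-cong []       eq = refl
countL-cong (x ∷ xs) eq = cong₂ _+_ (cong val (eq x)) (countL-cong xs eq)

countL-++ : {A : Set} (p : A → Bool) (xs ys : List A) →
            countL p (xs ++ ys) ≡ countL p xs + countL p ys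
countL-++ p []       ys = refl
countL-++ p (x ∷ xs) ys =
  trans (cong (val (p x) +_) (countL-++ p xs ys)) (sym (+-assoc (val (p x)) _ _))

countL-map : {A B : Set} (p : B → Bool) (f : A → B) (xs : List A) →
             countL p (map f xs) ≡ countL (p ∘ f) xs
countL-map p f []       = refl
countL-map p f (x ∷ xs) = cong (val (p (f x)) +_) (countL-map p f xs)

countL-tabulate : {A : Set} (p : A → Bool) (n : ℕ) (g : Fin n → A) →
                  countL p (tabulate g) ≡ sum (λ i → val (p (g i)))
countL-tabulate p zero    g = refl
countL-tabulate p (suc n) g = cong (val (p (g fzero)) +_) (countL-tabulate p n (g ∘ fsuc))

countL-pairs : {A B : Set} (p : A × B → Bool) (n : ℕ) (g : Fin n → A) (ys : List B) →
               countL p (cartesianProduct (tabulate g) ys)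
               ≡ sum (λ i → countL (λ y → p (g i , y)) ys)
countL-pairs p zero    g ys = refl
countL-pairs p (suc n) g ys = begin
  countL p (map (g fzero ,_) ys ++ cartesianProduct (tabulate (g ∘ fsuc)) ys)
    ≡⟨ countL-++ p (map (g fzero ,_) ys) _ ⟩
  countL p (map (g fzero ,_) ys) + countL p (cartesianProduct (tabulate (g ∘ fsuc)) ys)
    ≡⟨ cong₂ _+_ (countL-map p (g fzero ,_) ys) (countL-pairs p n (g ∘ fsuc) ys) ⟩
  countL (λ y → p (g fzero , y)) ys + sum (λ i → countL (λ y → p (g (fsuc i) , y)) ys) ∎
  where open ≡-Reasoning

countL-split : {A : Set} (p p₁ p₂ p₃ : A → Bool) (xs : List A) →
               (∀ x → val (p x) ≡ val (p₁ x) + val (p₂ x) + val (p₃ x)) →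
               countL p xs ≡ countL p₁ xs + countL p₂ xs + countL p₃ xs
countL-split p p₁ p₂ p₃ []       eq = refl
countL-split p p₁ p₂ p₃ (x ∷ xs) eq =
  trans (cong₂ _+_ (eq x) (countL-split p p₁ p₂ p₃ xs eq))
        (regroup (val (p₁ x)) (val (p₂ x)) (val (p₃ x)) (countL p₁ xs) (countL p₂ xs) (countL p₃ xs))
  where
  open +-*-Solver
  regroup : ∀ a b c d e f → a + b + c + (d + e + f) ≡ (a + d) + (b + e) + (c + f)
  regroup = solve 6 (λ a b c d e f → a :+ b :+ c :+ (d :+ e :+ f) := (a :+ d) :+ (b :+ e) :+ (c :+ f)) refl

sum-mono : ∀ {n} {f g : Fin n → ℕ} → (∀ i → f i ≤ g i) → sum f ≤ sum g
sum-mono {zero}  le = z≤n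
sum-mono {suc n} le = +-mono-≤ (le fzero) (sum-mono (le ∘ fsuc))

sum-tight : ∀ {n} {f g : Fin n → ℕ} → (∀ i → f i ≤ g i) → sum g ≤ sum f → ∀ i → f i ≡ g i
sum-tight {suc n} {f} {g} le sg≤sf fzero = ≤-antisym (le fzero)
  (+-cancelʳ-≤ (sum (g ∘ fsuc)) _ _
     (≤-trans sg≤sf (+-monoʳ-≤ (f fzero) (sum-mono (le ∘ fsuc)))))
sum-tight {suc n} {f} {g} le sg≤sf (fsuc i) = sum-tight (le ∘ fsuc)
  (+-cancelˡ-≤ (g fzero) _ _ (≤-trans sg≤sf (+-monoˡ-≤ _ (le fzero)))) i

sum-single : ∀ {n} {f : Fin n → ℕ} (e : Fin n) → (∀ i → i ≢ e → f i ≡ 0) → sum f ≡ f e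
sum-single {suc n} {f} fzero vanish =
  trans (cong (f fzero +_) (trans (sum-cong-≗ (λ i → vanish (fsuc i) λ ())) (sum-replicate-zero n)))
        (+-identityʳ (f fzero))
sum-single {suc n} {f} (fsuc e) vanish =
  trans (cong (_+ sum (f ∘ fsuc)) (vanish fzero λ ()))
        (sum-single e λ i i≢e → vanish (fsuc i) (i≢e ∘ fsuc-injective))

=F-refl : ∀ {n} (i : Fin n) → (i =F i) ≡ true
=F-refl i = trans (isYes≗does (i ≟F i)) (dec-true (i ≟F i) refl)

=F-≢ : ∀ {n} {i j : Fin n} → i ≢ j → (i =F j) ≡ false
=F-≢ {i = i} {j} i≢j = trans (isYes≗does (i ≟F j)) (dec-false (i ≟F j) i≢j)

=F-sound : ∀ {n} {i j : Fin n} → (i =F j) ≡ true → i ≡ j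
=F-sound {i = i} {j} eq = toWitness {a? = i ≟F j} (subst T (sym eq) tt)

sum-indicator : ∀ {n} (a : Fin n) (φ : Bool → Bool) → φ false ≡ false →
                sum (λ v → val (φ (a =F v))) ≡ val (φ true)
sum-indicator a φ φ-false =
  trans (sum-single a (λ v v≢a → cong val (trans (cong φ (=F-≢ (v≢a ∘ sym))) φ-false)))
        (cong (val ∘ φ) (=F-refl a))

-- Finite facts about Booleans and orientations are established by
-- deciding them: the decision procedures below are evaluated by the type
-- checker, and toWitness turns a successful run into a proof.

allBool? : {P : Bool → Set} → (∀ b → Dec (P b)) → Dec (∀ b → P b)
allBool? P? = map′ (λ { (f , t) → λ { false → f ; true → t } }) (λ h → h false , h true)
                   (P? false ×-dec P? true)

allOri? : {P : Ori → Set} → (∀ r → Dec (P r)) → Dec (∀ r → P r)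
allOri? P? = map′ (λ { (u , f , b) → λ { unor → u ; fwd → f ; bwd → b } })
                  (λ h → h unor , h fwd , h bwd)
                  (P? unor ×-dec P? fwd ×-dec P? bwd)

allGV? : {P : GV → Set} → (∀ g → Dec (P g)) → Dec (∀ g → P g)
allGV? P? = map′ (λ { (x , y , z , w , i , o) → λ { gx → x ; gy → y ; gz → z ; gw → w ; gin → i ; gout → o } })
                 (λ h → h gx , h gy , h gz , h gw , h gin , h gout)
                 (P? gx ×-dec P? gy ×-dec P? gz ×-dec P? gw ×-dec P? gin ×-dec P? gout)

allGE? : {P : GE → Set} → (∀ h → Dec (P h)) → Dec (∀ h → P h)
allGE? P? = map′ (λ { (a , b , c , d , e , f , g , h) → λ { eux → a ; exy → b ; exz → c ; eyw → d
                                                          ; ezw → e ; ewv → f ; eyin → g ; ezout → h } })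
                 (λ k → k eux , k exy , k exz , k eyw , k ezw , k ewv , k eyin , k ezout)
                 (P? eux ×-dec P? exy ×-dec P? exz ×-dec P? eyw ×-dec P? ezw ×-dec P? ewv ×-dec P? eyin ×-dec P? ezout)

_≟O_ : (r s : Ori) → Dec (r ≡ s)
unor ≟O unor = yes refl
unor ≟O fwd  = no λ ()
unor ≟O bwd  = no λ ()
fwd  ≟O unor = no λ ()
fwd  ≟O fwd  = yes refl
fwd  ≟O bwd  = no λ ()
bwd  ≟O unor = no λ ()
bwd  ≟O fwd  = no λ ()
bwd  ≟O bwd  = yes refl

Consistent : Bool → Bool → Ori → Set
Consistent a b r = (a ≡ b → r ≢ unor) × (r ≢ unor → a ≡ b)

consistent? : ∀ a b r → Dec (Consistent a b r)
consistent? a b r = (a ≟B b →-dec ¬? (r ≟O unor)) ×-dec (¬? (r ≟O unor) →-dec a ≟B b)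

data LVert : Set where
  endU endV : LVert
  inner     : GV → LVert

gadgetEnds : GE → LVert × LVert
gadgetEnds eux   = endU , inner gx
gadgetEnds exy   = inner gx , inner gy
gadgetEnds exz   = inner gx , inner gz
gadgetEnds eyw   = inner gy , inner gw
gadgetEnds ezw   = inner gz , inner gw
gadgetEnds ewv   = inner gw , endV
gadgetEnds eyin  = inner gy , inner gin
gadgetEnds ezout = inner gz , inner gout

LColouring : Set
LColouring = LVert → Bool

LArcs : Set
LArcs = GE → Ori

-- Counting at a vertex only needs, for each edge, whether its first and
-- its second end is that vertex (the incidence bits qa, qb).

headB : Ori → Bool → Bool → Bool
headB unor qa qb = false
headB fwd  qa qb = qb
headB bwd  qa qb = qa

tailB : Ori → Bool → Bool → Bool
tailB unor qa qb = false
tailB fwd  qa qb = qa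
tailB bwd  qa qb = qb

oppB : (qa qb ca cb cX : Bool) → Bool
oppB qa qb ca cb cX = (qa ∧ (cb xor cX)) ∨ (qb ∧ (ca xor cX))

headB-silent : ∀ r → headB r false false ≡ false
headB-silent unor = refl
headB-silent fwd  = refl
headB-silent bwd  = refl

tailB-silent : ∀ r → tailB r false false ≡ false
tailB-silent unor = refl
tailB-silent fwd  = refl
tailB-silent bwd  = refl

CountedOnce : (qa qb ca cb cX : Bool) → Ori → Set
CountedOnce qa qb ca cb cX r =
  qa ∧ qb ≡ false → (qa ≡ true → ca ≡ cX) → (qb ≡ true → cb ≡ cX) → Consistent ca cb r →
  val (qa ∨ qb) ≡ val (oppB qa qb ca cb cX) + val (headB r qa qb) + val (tailB r qa qb)

countedOnce? : ∀ qa qb ca cb cX r → Dec (CountedOnce qa qb ca cb cX r)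
countedOnce? qa qb ca cb cX r =
  (qa ∧ qb ≟B false) →-dec (qa ≟B true →-dec ca ≟B cX) →-dec (qb ≟B true →-dec cb ≟B cX) →-dec
  consistent? ca cb r →-dec
  (val (qa ∨ qb) ≟ℕ val (oppB qa qb ca cb cX) + val (headB r qa qb) + val (tailB r qa qb))

edgeOnce : ∀ qa qb ca cb cX r → CountedOnce qa qb ca cb cX r
edgeOnce = toWitness {a? = allBool? λ qa → allBool? λ qb → allBool? λ ca → allBool? λ cb →
                           allBool? λ cX → allOri? λ r → countedOnce? qa qb ca cb cX r} tt

countAt : (GE → Bool → Bool → Bool) → (LVert → Bool) → ℕ
countAt t q = countL (λ h → t h (q (proj₁ (gadgetEnds h))) (q (proj₂ (gadgetEnds h)))) allGE

degAt : (LVert → Bool) → ℕ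
degAt = countAt (λ _ → _∨_)

oppAt : LColouring → Bool → (LVert → Bool) → ℕ
oppAt C cX = countAt (λ h qa qb → oppB qa qb (C (proj₁ (gadgetEnds h))) (C (proj₂ (gadgetEnds h))) cX)

inAt : LArcs → (LVert → Bool) → ℕ
inAt O = countAt (λ h → headB (O h))

outAt : LArcs → (LVert → Bool) → ℕ
outAt O = countAt (λ h → tailB (O h))

countAt-cong : ∀ t {q q'} → (∀ l → q l ≡ q' l) → countAt t q ≡ countAt t q'
countAt-cong t eq = countL-cong allGE λ h → cong₂ (t h) (eq (proj₁ (gadgetEnds h))) (eq (proj₂ (gadgetEnds h)))

countAt-none : ∀ t {q} → (∀ h → t h false false ≡ false) → (∀ l → q l ≡ false) → countAt t q ≡ 0
countAt-none t silent none = trans (countAt-cong t none) (countL-cong allGE silent)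

EndsOnly : (LVert → Bool) → Set
EndsOnly q = ∀ g → q (inner g) ≡ false

countAt-ends : ∀ t {q} → (∀ h → t h false false ≡ false) → EndsOnly q →
               countAt t q ≡ val (t eux (q endU) false) + val (t ewv false (q endV))
countAt-ends t {q} silent endsOnly =
  trans (countL-cong allGE endTerm) (cong (val (t eux (q endU) false) +_) (+-identityʳ _))
  where
  onEnds : GE → Bool
  onEnds eux = t eux (q endU) false
  onEnds ewv = t ewv false (q endV)
  onEnds _   = false

  endTerm : ∀ h → t h (q (proj₁ (gadgetEnds h))) (q (proj₂ (gadgetEnds h))) ≡ onEnds h
  endTerm eux   = cong (t eux (q endU)) (endsOnly gx)
  endTerm exy   = trans (cong₂ (t exy) (endsOnly gx) (endsOnly gy)) (silent exy)
  endTerm exz   = trans (cong₂ (t exz) (endsOnly gx) (endsOnly gz)) (silent exz)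
  endTerm eyw   = trans (cong₂ (t eyw) (endsOnly gy) (endsOnly gw)) (silent eyw)
  endTerm ezw   = trans (cong₂ (t ezw) (endsOnly gz) (endsOnly gw)) (silent ezw)
  endTerm ewv   = cong (λ b → t ewv b (q endV)) (endsOnly gw)
  endTerm eyin  = trans (cong₂ (t eyin) (endsOnly gy) (endsOnly gin)) (silent eyin)
  endTerm ezout = trans (cong₂ (t ezout) (endsOnly gz) (endsOnly gout)) (silent ezout)

isInner : GV → LVert → Bool
isInner g (inner g') = g' =G g
isInner g _          = false

degIn : GV → ℕ
degIn g = degAt (isInner g)

oppIn : LColouring → GV → ℕ
oppIn C g = oppAt C (C (inner g)) (isInner g)

inIn : LArcs → GV → ℕ
inIn O g = inAt O (isInner g)

outIn : LArcs → GV → ℕ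
outIn O g = outAt O (isInner g)

GadgetConsistent : LColouring → LArcs → Set
GadgetConsistent C O = ∀ h → Consistent (C (proj₁ (gadgetEnds h))) (C (proj₂ (gadgetEnds h))) (O h)

localSplit : ∀ C O cX q →
             (∀ h → q (proj₁ (gadgetEnds h)) ∧ q (proj₂ (gadgetEnds h)) ≡ false) →
             (∀ l → q l ≡ true → C l ≡ cX) → GadgetConsistent C O →
             degAt q ≡ oppAt C cX q + inAt O q + outAt O q
localSplit C O cX q noLoop colour consistent = countL-split _ bichromatic entering leaving allGE λ h →
  edgeOnce _ _ _ _ cX (O h) (noLoop h) (colour (proj₁ (gadgetEnds h))) (colour (proj₂ (gadgetEnds h)))
           (consistent h)
  where
  bichromatic entering leaving : GE → Bool
  bichromatic h = oppB (q (proj₁ (gadgetEnds h))) (q (proj₂ (gadgetEnds h)))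
                (C (proj₁ (gadgetEnds h))) (C (proj₂ (gadgetEnds h))) cX
  entering h = headB (O h) (q (proj₁ (gadgetEnds h))) (q (proj₂ (gadgetEnds h)))
  leaving h = tailB (O h) (q (proj₁ (gadgetEnds h))) (q (proj₂ (gadgetEnds h)))

-- the hypotheses a coloured orientation of H imposes on one gadget:
-- x, y, z, w have at most one neighbour of the other colour and
-- indegree at most one, and the outvertex has indegree zero
Bounded : LColouring → LArcs → GV → Set
Bounded C O g = oppIn C g ≤ 1 × inIn O g ≤ 1

GadgetHyp : LColouring → LArcs → Set
GadgetHyp C O = Bounded C O gx × Bounded C O gy × Bounded C O gz × Bounded C O gw × inIn O gout ≡ 0

endOut : LArcs → ℕ
endOut O = val (tailB (O eux) true false) + val (tailB (O ewv) false true)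

endIn : LArcs → ℕ
endIn O = val (headB (O eux) true false) + val (headB (O ewv) false true)

-- The three balanced patterns, according to the state k of the edge ux
-- (u has colour a): both end edges are in state k, and
--   k unoriented:  v has colour a,      x and w colour ¬a;
--   k oriented:    v and w colour ¬a,   x colour a.
colourV : Ori → Bool → Bool
colourV unor a = a
colourV _    a = not a

colourX : Ori → Bool → Bool
colourX unor a = not a
colourX _    a = a

Balanced : (k wv : Ori) (a cv cx cw : Bool) → Set
Balanced k wv a cv cx cw = (wv ≡ k) × (cv ≡ colourV k a) × (cx ≡ colourX k a) × (cw ≡ not a)

balanced? : ∀ k wv a cv cx cw → Dec (Balanced k wv a cv cx cw)
balanced? k wv a cv cx cw = wv ≟O k ×-dec cv ≟B colourV k a ×-dec cx ≟B colourX k a ×-dec cw ≟B not a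

GadgetConcl : LColouring → LArcs → Set
GadgetConcl C O = endOut O ≤ endIn O ×
  (endOut O ≡ endIn O → Balanced (O eux) (O ewv) (C endU) (C endV) (C (inner gx)) (C (inner gw)))

colouringOf : (cu cv cx cy cz cw ci co : Bool) → LColouring
colouringOf cu cv cx cy cz cw ci co endU         = cu
colouringOf cu cv cx cy cz cw ci co endV         = cv
colouringOf cu cv cx cy cz cw ci co (inner gx)   = cx
colouringOf cu cv cx cy cz cw ci co (inner gy)   = cy
colouringOf cu cv cx cy cz cw ci co (inner gz)   = cz
colouringOf cu cv cx cy cz cw ci co (inner gw)   = cw
colouringOf cu cv cx cy cz cw ci co (inner gin)  = ci
colouringOf cu cv cx cy cz cw ci co (inner gout) = co

arcsOf : (ux xy xz yw zw wv yi zo : Ori) → LArcs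
arcsOf ux xy xz yw zw wv yi zo eux   = ux
arcsOf ux xy xz yw zw wv yi zo exy   = xy
arcsOf ux xy xz yw zw wv yi zo exz   = xz
arcsOf ux xy xz yw zw wv yi zo eyw   = yw
arcsOf ux xy xz yw zw wv yi zo ezw   = zw
arcsOf ux xy xz yw zw wv yi zo ewv   = wv
arcsOf ux xy xz yw zw wv yi zo eyin  = yi
arcsOf ux xy xz yw zw wv yi zo ezout = zo

GadgetFact : (cu cv cx cy cz cw ci co : Bool) → Set
GadgetFact cu cv cx cy cz cw ci co =
  ∀ ux → Consistent cu cx ux → ∀ xy → Consistent cx cy xy → ∀ xz → Consistent cx cz xz →
  ∀ yw → Consistent cy cw yw → ∀ zw → Consistent cz cw zw → ∀ wv → Consistent cw cv wv →
  ∀ yi → Consistent cy ci yi → ∀ zo → Consistent cz co zo →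
  let C = colouringOf cu cv cx cy cz cw ci co ; O = arcsOf ux xy xz yw zw wv yi zo in
  GadgetHyp C O → GadgetConcl C O

-- for fixed colours the decision runs through the edge states one edge at a
-- time; an inconsistent state short-circuits →-dec, so only the consistent
-- configurations are examined
gadgetFact? : ∀ cu cv cx cy cz cw ci co → Dec (GadgetFact cu cv cx cy cz cw ci co)
gadgetFact? cu cv cx cy cz cw ci co =
  allOri? λ ux → consistent? cu cx ux →-dec allOri? λ xy → consistent? cx cy xy →-dec
  allOri? λ xz → consistent? cx cz xz →-dec allOri? λ yw → consistent? cy cw yw →-dec
  allOri? λ zw → consistent? cz cw zw →-dec allOri? λ wv → consistent? cw cv wv →-dec
  allOri? λ yi → consistent? cy ci yi →-dec allOri? λ zo → consistent? cz co zo →-dec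
  (hyp? (arcsOf ux xy xz yw zw wv yi zo) →-dec concl? (arcsOf ux xy xz yw zw wv yi zo))
  where
  C : LColouring
  C = colouringOf cu cv cx cy cz cw ci co
  bounded? : ∀ O g → Dec (Bounded C O g)
  bounded? O g = oppIn C g ≤? 1 ×-dec inIn O g ≤? 1
  hyp? : ∀ O → Dec (GadgetHyp C O)
  hyp? O = bounded? O gx ×-dec bounded? O gy ×-dec bounded? O gz ×-dec bounded? O gw ×-dec
           inIn O gout ≟ℕ 0
  concl? : ∀ O → Dec (GadgetConcl C O)
  concl? O = endOut O ≤? endIn O ×-dec
             (endOut O ≟ℕ endIn O →-dec balanced? (O eux) (O ewv) cu cv cx cw)

gadgetFact : ∀ cu cv cx cy cz cw ci co → GadgetFact cu cv cx cy cz cw ci co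
gadgetFact = toWitness {a? = allBool? λ cu → allBool? λ cv → allBool? λ cx → allBool? λ cy →
                             allBool? λ cz → allBool? λ cw → allBool? λ ci → allBool? λ co →
                             gadgetFact? cu cv cx cy cz cw ci co} tt

gadgetLemma : (C : LColouring) (O : LArcs) → GadgetConsistent C O → GadgetHyp C O → GadgetConcl C O
gadgetLemma C O k = gadgetFact
  (C endU) (C endV) (C (inner gx)) (C (inner gy)) (C (inner gz)) (C (inner gw)) (C (inner gin)) (C (inner gout))
  (O eux) (k eux) (O exy) (k exy) (O exz) (k exz) (O eyw) (k eyw)
  (O ezw) (k ezw) (O ewv) (k ewv) (O eyin) (k eyin) (O ezout) (k ezout)

-- Keeping u, v, x, w and the end edges of a balanced gadget of kind k,
-- the inner part is replaced by a fixed pattern in which x, y, z, w all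
-- have one neighbour of the other colour, one incoming and one outgoing
-- arc:
--   k unoriented:  y, z coloured like x; cycle x → y → w → z → x;
--                  in, out coloured like u, both pendant edges bichromatic;
--   k forward:     u → x → y → in,  z → w → v,  out → z;
--   k backward:    v → w → y → in,  out → z → x → u.

repairedColour : (k : Ori) (a cv cx cw : Bool) → LColouring
repairedColour k    a cv cx cw endU         = a
repairedColour k    a cv cx cw endV         = cv
repairedColour k    a cv cx cw (inner gx)   = cx
repairedColour k    a cv cx cw (inner gw)   = cw
repairedColour unor a cv cx cw (inner gy)   = not a
repairedColour unor a cv cx cw (inner gz)   = not a
repairedColour unor a cv cx cw (inner gin)  = a
repairedColour unor a cv cx cw (inner gout) = a
repairedColour fwd  a cv cx cw (inner gy)   = a
repairedColour fwd  a cv cx cw (inner gz)   = not a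
repairedColour fwd  a cv cx cw (inner gin)  = a
repairedColour fwd  a cv cx cw (inner gout) = not a
repairedColour bwd  a cv cx cw (inner gy)   = not a
repairedColour bwd  a cv cx cw (inner gz)   = a
repairedColour bwd  a cv cx cw (inner gin)  = not a
repairedColour bwd  a cv cx cw (inner gout) = a

repairedArcs : (k wv : Ori) → LArcs
repairedArcs k    wv eux   = k
repairedArcs k    wv ewv   = wv
repairedArcs unor wv exy   = fwd
repairedArcs unor wv exz   = bwd
repairedArcs unor wv eyw   = fwd
repairedArcs unor wv ezw   = bwd
repairedArcs unor wv eyin  = unor
repairedArcs unor wv ezout = unor
repairedArcs fwd  wv exy   = fwd
repairedArcs fwd  wv exz   = unor
repairedArcs fwd  wv eyw   = unor
repairedArcs fwd  wv ezw   = fwd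
repairedArcs fwd  wv eyin  = fwd
repairedArcs fwd  wv ezout = bwd
repairedArcs bwd  wv exy   = unor
repairedArcs bwd  wv exz   = bwd
repairedArcs bwd  wv eyw   = bwd
repairedArcs bwd  wv ezw   = unor
repairedArcs bwd  wv eyin  = fwd
repairedArcs bwd  wv ezout = bwd

IsOut : GV → Set
IsOut g = T (g =G gout)

GoodAt : LColouring → LArcs → GV → Set
GoodAt C O g = oppIn C g ≤ 1
             × (¬ IsOut g → inIn O g ≤ 1 × outIn O g ≤ 2)
             × (IsOut g → inIn O g ≡ 0)
             × (degIn g ≡ 3 → oppIn C g ≡ 1 × inIn O g ≡ 1 × outIn O g ≡ 1)

goodAt? : ∀ C O g → Dec (GoodAt C O g)
goodAt? C O g = oppIn C g ≤? 1
          ×-dec (¬? (T? (g =G gout)) →-dec inIn O g ≤? 1 ×-dec outIn O g ≤? 2)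
          ×-dec (T? (g =G gout) →-dec inIn O g ≟ℕ 0)
          ×-dec (degIn g ≟ℕ 3 →-dec oppIn C g ≟ℕ 1 ×-dec inIn O g ≟ℕ 1 ×-dec outIn O g ≟ℕ 1)

Repairable : (k wv : Ori) (a cv cx cw : Bool) → Set
Repairable k wv a cv cx cw = Balanced k wv a cv cx cw →
  GadgetConsistent (repairedColour k a cv cx cw) (repairedArcs k wv)
  × (∀ g → GoodAt (repairedColour k a cv cx cw) (repairedArcs k wv) g)

repairLemma : ∀ k wv a cv cx cw → Repairable k wv a cv cx cw
repairLemma = toWitness {a? = allOri? λ k → allOri? λ wv → allBool? λ a → allBool? λ cv →
                              allBool? λ cx → allBool? λ cw → repairable? k wv a cv cx cw} tt
  where
  repairable? : ∀ k wv a cv cx cw → Dec (Repairable k wv a cv cx cw)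
  repairable? k wv a cv cx cw = balanced? k wv a cv cx cw →-dec
    allGE? (λ h → consistent? (C (proj₁ (gadgetEnds h))) (C (proj₂ (gadgetEnds h))) (repairedArcs k wv h))
    ×-dec allGV? (goodAt? C (repairedArcs k wv))
    where
    C : LColouring
    C = repairedColour k a cv cx cw

module Localisation (G : Graph) where

  source target : Fin (nE G) → Fin (nV G)
  source f = proj₁ (ends G f)
  target f = proj₂ (ends G f)

  emb : Fin (nE G) → LVert → VH G
  emb f endU      = inj₁ (source f)
  emb f endV      = inj₁ (target f)
  emb f (inner g) = inj₂ (f , g)

  atVertex : VH G → Fin (nE G) → LVert → Bool
  atVertex X f l = emb f l =V X

  colourAt : Colouring G → Fin (nE G) → LColouring
  colourAt c f = c ∘ emb f

  arcsAt : Orientation G → Fin (nE G) → LArcs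
  arcsAt o f h = o (f , h)

  endsH-emb : ∀ f h → endsH G (f , h) ≡ (emb f (proj₁ (gadgetEnds h)) , emb f (proj₂ (gadgetEnds h)))
  endsH-emb f eux   = refl
  endsH-emb f exy   = refl
  endsH-emb f exz   = refl
  endsH-emb f eyw   = refl
  endsH-emb f ezw   = refl
  endsH-emb f ewv   = refl
  endsH-emb f eyin  = refl
  endsH-emb f ezout = refl

  ConsistentH : Colouring G → Orientation G → Set
  ConsistentH c o = ∀ E → Consistent (c (proj₁ (endsH G E))) (c (proj₂ (endsH G E))) (o E)

  localConsistent : ∀ {c o} → ConsistentH c o → ∀ f → GadgetConsistent (colourAt c f) (arcsAt o f)
  localConsistent {c} {o} k f h =
    subst (λ p → Consistent (c (proj₁ p)) (c (proj₂ p)) (o (f , h))) (endsH-emb f h) (k (f , h))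

  globalConsistent : ∀ {c o} → (∀ f → GadgetConsistent (colourAt c f) (arcsAt o f)) → ConsistentH c o
  globalConsistent {c} {o} k (f , h) =
    subst (λ p → Consistent (c (proj₁ p)) (c (proj₂ p)) (o (f , h))) (sym (endsH-emb f h)) (k f h)

  countH : (t : EH G → Bool → Bool → Bool) (X : VH G) →
           countL (λ E → t E (proj₁ (endsH G E) =V X) (proj₂ (endsH G E) =V X)) (edgesH G)
           ≡ sum (λ f → countAt (λ h → t (f , h)) (atVertex X f))
  countH t X = countL-pairs _ (nE G) (λ f → f) allGE

  degH-local : ∀ X → degH G X ≡ sum (λ f → degAt (atVertex X f))
  degH-local = countH (λ _ → _∨_)

  oppDeg-local : ∀ c X → oppDeg G c X ≡ sum (λ f → oppAt (colourAt c f) (c X) (atVertex X f))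
  oppDeg-local c X = countH (λ E qa qb → oppB qa qb (c (proj₁ (endsH G E))) (c (proj₂ (endsH G E))) (c X)) X

  inDeg-local : ∀ o X → inDeg G o X ≡ sum (λ f → inAt (arcsAt o f) (atVertex X f))
  inDeg-local o X = trans (countL-cong (edgesH G) λ E → isHead-headB (o E)) (countH (λ E → headB (o E)) X)
    where
    isHead-headB : ∀ r {p} → isHead G r p X ≡ headB r (proj₁ p =V X) (proj₂ p =V X)
    isHead-headB unor = refl
    isHead-headB fwd  = refl
    isHead-headB bwd  = refl

  outDeg-local : ∀ o X → outDeg G o X ≡ sum (λ f → outAt (arcsAt o f) (atVertex X f))
  outDeg-local o X = trans (countL-cong (edgesH G) λ E → isTail-tailB (o E)) (countH (λ E → tailB (o E)) X)
    where
    isTail-tailB : ∀ r {p} → isTail G r p X ≡ tailB r (proj₁ p =V X) (proj₂ p =V X)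
    isTail-tailB unor = refl
    isTail-tailB fwd  = refl
    isTail-tailB bwd  = refl

  atInner : ∀ (t : Fin (nE G) → GE → Bool → Bool → Bool) e g → (∀ f h → t f h false false ≡ false) →
            sum (λ f → countAt (t f) (atVertex (inj₂ (e , g)) f)) ≡ countAt (t e) (isInner g)
  atInner t e g silent =
    trans (sum-single e λ f f≢e → countAt-none (t f) (silent f) (elsewhere f f≢e))
          (countAt-cong (t e) here)
    where
    elsewhere : ∀ f → f ≢ e → ∀ l → atVertex (inj₂ (e , g)) f l ≡ false
    elsewhere f f≢e endU       = refl
    elsewhere f f≢e endV       = refl
    elsewhere f f≢e (inner g') = cong (_∧ (g' =G g)) (=F-≢ f≢e)
    here : ∀ l → atVertex (inj₂ (e , g)) e l ≡ isInner g l
    here endU       = refl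
    here endV       = refl
    here (inner g') = cong (_∧ (g' =G g)) (=F-refl e)

  degH-inner : ∀ e g → degH G (inj₂ (e , g)) ≡ degIn g
  degH-inner e g = trans (degH-local _) (atInner (λ _ _ → _∨_) e g λ _ _ → refl)

  oppDeg-inner : ∀ c e g → oppDeg G c (inj₂ (e , g)) ≡ oppIn (colourAt c e) g
  oppDeg-inner c e g = trans (oppDeg-local c _)
    (atInner (λ f h qa qb → oppB qa qb (colourAt c f (proj₁ (gadgetEnds h))) (colourAt c f (proj₂ (gadgetEnds h)))
                                 (c (inj₂ (e , g))))
             e g λ _ _ → refl)

  inDeg-inner : ∀ o e g → inDeg G o (inj₂ (e , g)) ≡ inIn (arcsAt o e) g
  inDeg-inner o e g = trans (inDeg-local o _) (atInner (λ f h → headB (o (f , h))) e g λ _ _ → headB-silent _)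

  outDeg-inner : ∀ o e g → outDeg G o (inj₂ (e , g)) ≡ outIn (arcsAt o e) g
  outDeg-inner o e g = trans (outDeg-local o _) (atInner (λ f h → tailB (o (f , h))) e g λ _ _ → tailB-silent _)

  inDeg-original : ∀ o v → inDeg G o (inj₁ v) ≡
    sum (λ f → val (headB (o (f , eux)) (source f =F v) false) + val (headB (o (f , ewv)) false (target f =F v)))
  inDeg-original o v = trans (inDeg-local o _) (sum-cong-≗ λ f →
    countAt-ends (λ h → headB (o (f , h))) {atVertex (inj₁ v) f} (λ _ → headB-silent _) λ _ → refl)

  outDeg-original : ∀ o v → outDeg G o (inj₁ v) ≡
    sum (λ f → val (tailB (o (f , eux)) (source f =F v) false) + val (tailB (o (f , ewv)) false (target f =F v)))
  outDeg-original o v = trans (outDeg-local o _) (sum-cong-≗ λ f →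
    countAt-ends (λ h → tailB (o (f , h))) {atVertex (inj₁ v) f} (λ _ → tailB-silent _) λ _ → refl)

  sum-original : (t : Fin (nE G) → GE → Bool → Bool → Bool) → (∀ f h → t f h false false ≡ false) →
    sum (λ v → sum (λ f → val (t f eux (source f =F v) false) + val (t f ewv false (target f =F v))))
    ≡ sum (λ f → val (t f eux true false) + val (t f ewv false true))
  sum-original t silent = trans (∑-comm term) (sum-cong-≗ λ f →
    trans (∑-distrib-+ (λ v → val (t f eux (source f =F v) false)) (λ v → val (t f ewv false (target f =F v))))
          (cong₂ _+_ (sum-indicator (source f) (λ b → t f eux b false) (silent f eux))
                     (sum-indicator (target f) (t f ewv false) (silent f ewv))))
    where
    term : Fin (nV G) → Fin (nE G) → ℕ
    term v f = val (t f eux (source f =F v) false) + val (t f ewv false (target f =F v))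

out≥1 : ∀ {a b c} → 3 ≡ a + b + c → a ≤ 1 → b ≤ 1 → 1 ≤ c
out≥1 {a} {b} {c} eq a≤1 b≤1 =
  +-cancelˡ-≤ 2 1 c (subst (_≤ 2 + c) (sym eq) (+-monoˡ-≤ c (+-mono-≤ a≤1 b≤1)))

opp≡1 : ∀ a → 3 ≡ a + 1 + 1 → a ≡ 1
opp≡1 a eq = sym (suc-injective (suc-injective (trans eq (solve 1 (λ a → a :+ con 1 :+ con 1 := con 2 :+ a) refl a))))
  where open +-*-Solver

val-∨ : ∀ a b → a ∧ b ≡ false → val (a ∨ b) ≡ val (a ∨ false) + val (false ∨ b)
val-∨ false false _  = refl
val-∨ false true  _  = refl
val-∨ true  false _  = refl
val-∨ true  true  ()

module Counting (G : Graph) (simple : Simple G) (cubic : Cubic G)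
                (c : Colouring G) (o : Orientation G) (co : ColouredOrientation G c o) where
  open Localisation G
  open ColouredOrientation co

  gadgetConsistent : ∀ f → GadgetConsistent (colourAt c f) (arcsAt o f)
  gadgetConsistent = localConsistent {c} {o} λ E → orientedIfMono E , monoIfOriented E

  gadgetHyp : ∀ f → GadgetHyp (colourAt c f) (arcsAt o f)
  gadgetHyp f = bounded gx (λ { (_ , ()) }) , bounded gy (λ { (_ , ()) }) ,
                bounded gz (λ { (_ , ()) }) , bounded gw (λ { (_ , ()) }) ,
                trans (sym (inDeg-inner o f gout)) (outvertexIn _ (f , refl))
    where
    bounded : ∀ g → ¬ Outvertex G (inj₂ (f , g)) → Bounded (colourAt c f) (arcsAt o f) g
    bounded g notOut = subst (_≤ 1) (oppDeg-inner c f g) (atMostOneOpposite _) ,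
                       subst (_≤ 1) (inDeg-inner o f g) (inBound _ notOut)

  endBalance : ∀ f → GadgetConcl (colourAt c f) (arcsAt o f)
  endBalance f = gadgetLemma (colourAt c f) (arcsAt o f) (gadgetConsistent f) (gadgetHyp f)

  noLoop : ∀ f v → (source f =F v) ∧ (target f =F v) ≡ false
  noLoop f v with source f =F v in eqU | target f =F v in eqV
  ... | false | _     = refl
  ... | true  | false = refl
  ... | true  | true  = ⊥-elim (proj₁ simple f (trans (=F-sound eqU) (sym (=F-sound eqV))))

  split : ∀ v → 3 ≡ oppDeg G c (inj₁ v) + inDeg G o (inj₁ v) + outDeg G o (inj₁ v)
  split v = begin
    3                                                  ≡⟨ sym (cubic v) ⟩
    degG G v                                           ≡⟨ countL-tabulate _ (nE G) (λ f → f) ⟩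
    sum (λ f → val ((source f =F v) ∨ (target f =F v))) ≡⟨ sum-cong-≗ edgeSplit ⟩
    sum (λ f → oppE f + inE f + outE f)                  ≡⟨ ∑-distrib-+ (λ f → oppE f + inE f) outE ⟩
    sum (λ f → oppE f + inE f) + sum outE                ≡⟨ cong (_+ sum outE) (∑-distrib-+ oppE inE) ⟩
    sum oppE + sum inE + sum outE                        ≡⟨ sym (cong₂ _+_ (cong₂ _+_ (oppDeg-local c _) (inDeg-local o _))
                                                                       (outDeg-local o _)) ⟩
    oppDeg G c (inj₁ v) + inDeg G o (inj₁ v) + outDeg G o (inj₁ v) ∎
    where
    open ≡-Reasoning
    oppE inE outE : Fin (nE G) → ℕ
    oppE f = oppAt (colourAt c f) (c (inj₁ v)) (atVertex (inj₁ v) f)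
    inE f = inAt (arcsAt o f) (atVertex (inj₁ v) f)
    outE f = outAt (arcsAt o f) (atVertex (inj₁ v) f)
    edgeSplit : ∀ f → val ((source f =F v) ∨ (target f =F v)) ≡ oppE f + inE f + outE f
    edgeSplit f = trans (val-∨ (source f =F v) (target f =F v) (noLoop f v))
      (trans (sym (countAt-ends (λ _ → _∨_) {atVertex (inj₁ v) f} (λ _ → refl) (λ _ → refl)))
             (localSplit (colourAt c f) (arcsAt o f) (c (inj₁ v)) (atVertex (inj₁ v) f)
                         noLoopInGadget colour (gadgetConsistent f)))
      where
      noLoopInGadget : ∀ h → atVertex (inj₁ v) f (proj₁ (gadgetEnds h)) ∧ atVertex (inj₁ v) f (proj₂ (gadgetEnds h)) ≡ false
      noLoopInGadget eux   = ∧-zeroʳ _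
      noLoopInGadget exy   = refl
      noLoopInGadget exz   = refl
      noLoopInGadget eyw   = refl
      noLoopInGadget ezw   = refl
      noLoopInGadget ewv   = refl
      noLoopInGadget eyin  = refl
      noLoopInGadget ezout = refl
      colour : ∀ l → atVertex (inj₁ v) f l ≡ true → colourAt c f l ≡ c (inj₁ v)
      colour endU      at = cong (c ∘ inj₁) (=F-sound at)
      colour endV      at = cong (c ∘ inj₁) (=F-sound at)
      colour (inner g) ()

  inDeg≤1 : ∀ v → inDeg G o (inj₁ v) ≤ 1
  inDeg≤1 v = inBound _ λ { (_ , ()) }

  outDeg≥1 : ∀ v → 1 ≤ outDeg G o (inj₁ v)
  outDeg≥1 v = out≥1 (split v) (atMostOneOpposite _) (inDeg≤1 v)

  sumOut : sum (λ v → outDeg G o (inj₁ v)) ≡ sum (λ f → endOut (arcsAt o f))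
  sumOut = trans (sum-cong-≗ (outDeg-original o)) (sum-original (λ f h → tailB (o (f , h))) λ _ _ → tailB-silent _)

  sumIn : sum (λ v → inDeg G o (inj₁ v)) ≡ sum (λ f → endIn (arcsAt o f))
  sumIn = trans (sum-cong-≗ (inDeg-original o)) (sum-original (λ f h → headB (o (f , h))) λ _ _ → headB-silent _)

  outFlow≤inFlow : sum (λ v → outDeg G o (inj₁ v)) ≤ sum (λ v → inDeg G o (inj₁ v))
  outFlow≤inFlow = subst₂ _≤_ (sym sumOut) (sym sumIn) (sum-mono (proj₁ ∘ endBalance))

  -- hence  Σ out ≤ Σ in ≤ |V(G)| ≤ Σ out  is tight everywhere
  inDeg≡1 : ∀ v → inDeg G o (inj₁ v) ≡ 1
  inDeg≡1 = sum-tight inDeg≤1 (≤-trans (sum-mono outDeg≥1) outFlow≤inFlow)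

  outDeg≡1 : ∀ v → outDeg G o (inj₁ v) ≡ 1
  outDeg≡1 v = sym (sum-tight outDeg≥1 (≤-trans outFlow≤inFlow (sum-mono inDeg≤1)) v)

  oppDeg≡1 : ∀ v → oppDeg G c (inj₁ v) ≡ 1
  oppDeg≡1 v = opp≡1 _ (subst₂ (λ i j → 3 ≡ oppDeg G c (inj₁ v) + i + j) (inDeg≡1 v) (outDeg≡1 v) (split v))

  -- and by (2) every gadget is balanced
  balanced : ∀ f → Balanced (o (f , eux)) (o (f , ewv)) (c (inj₁ (source f))) (c (inj₁ (target f)))
                            (c (inj₂ (f , gx))) (c (inj₂ (f , gw)))
  balanced f = proj₂ (endBalance f) (sum-tight (proj₁ ∘ endBalance) inFlow≤outFlow f)
    where
    inFlow≤outFlow : sum (λ f → endIn (arcsAt o f)) ≤ sum (λ f → endOut (arcsAt o f))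
    inFlow≤outFlow = subst₂ _≤_ sumIn sumOut
      (≤-reflexive (trans (sum-cong-≗ inDeg≡1) (sym (sum-cong-≗ outDeg≡1))))

module Repair (G : Graph) (c : Colouring G) (o : Orientation G)
  (balanced : ∀ f → Balanced (o (f , eux)) (o (f , ewv))
                             (c (inj₁ (Localisation.source G f))) (c (inj₁ (Localisation.target G f)))
                             (c (inj₂ (f , gx))) (c (inj₂ (f , gw))))
  where
  open Localisation G

  repairedAt : Fin (nE G) → LColouring
  repairedAt f = repairedColour (o (f , eux)) (c (inj₁ (source f))) (c (inj₁ (target f)))
                                (c (inj₂ (f , gx))) (c (inj₂ (f , gw)))

  c' : Colouring G
  c' (inj₁ v)       = c (inj₁ v)
  c' (inj₂ (f , g)) = repairedAt f (inner g)

  o' : Orientation G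
  o' (f , h) = repairedArcs (o (f , eux)) (o (f , ewv)) h

  colourAt-c' : ∀ f l → repairedAt f l ≡ colourAt c' f l
  colourAt-c' f endU      = refl
  colourAt-c' f endV      = refl
  colourAt-c' f (inner g) = refl

  repaired : ∀ f → Repairable (o (f , eux)) (o (f , ewv)) (c (inj₁ (source f))) (c (inj₁ (target f)))
                             (c (inj₂ (f , gx))) (c (inj₂ (f , gw)))
  repaired f = repairLemma (o (f , eux)) (o (f , ewv)) (c (inj₁ (source f))) (c (inj₁ (target f)))
                           (c (inj₂ (f , gx))) (c (inj₂ (f , gw)))

  consistent' : ConsistentH c' o'
  consistent' = globalConsistent {c'} {o'} λ f h →
    subst₂ (λ a b → Consistent a b (o' (f , h))) (colourAt-c' f (proj₁ (gadgetEnds h))) (colourAt-c' f (proj₂ (gadgetEnds h)))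
           (proj₁ (repaired f (balanced f)) h)

  goodInner : ∀ e g → GoodAt (repairedAt e) (arcsAt o' e) g
  goodInner e = proj₂ (repaired e (balanced e))

  -- the counts at original vertices only see the unchanged end edges and x, w
  oppSame : ∀ v → oppDeg G c' (inj₁ v) ≡ oppDeg G c (inj₁ v)
  oppSame v = trans (oppDeg-local c' _) (sym (oppDeg-local c _))

  inSame : ∀ v → inDeg G o' (inj₁ v) ≡ inDeg G o (inj₁ v)
  inSame v = trans (inDeg-original o' v) (sym (inDeg-original o v))

  outSame : ∀ v → outDeg G o' (inj₁ v) ≡ outDeg G o (inj₁ v)
  outSame v = trans (outDeg-original o' v) (sym (outDeg-original o v))

  isOut⇒outvertex : ∀ e g → IsOut g → Outvertex G (inj₂ (e , g))
  isOut⇒outvertex e gout _ = e , refl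

  module _ (oppDeg≡1 : ∀ v → oppDeg G c (inj₁ v) ≡ 1) (inDeg≡1 : ∀ v → inDeg G o (inj₁ v) ≡ 1)
           (outDeg≡1 : ∀ v → outDeg G o (inj₁ v) ≡ 1) where

    atMostOne : ∀ X → oppDeg G c' X ≤ 1
    atMostOne (inj₁ v)       = ≤-reflexive (trans (oppSame v) (oppDeg≡1 v))
    atMostOne (inj₂ (e , g)) = subst (_≤ 1) (sym (oppDeg-inner c' e g)) (proj₁ (goodInner e g))

    bounds : ∀ X → ¬ Outvertex G X → inDeg G o' X ≤ 1 × outDeg G o' X ≤ 2
    bounds (inj₁ v) _ = ≤-reflexive (trans (inSame v) (inDeg≡1 v)) ,
                        ≤-trans (≤-reflexive (trans (outSame v) (outDeg≡1 v))) (s≤s z≤n)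
    bounds (inj₂ (e , g)) notOut =
      subst (_≤ 1) (sym (inDeg-inner o' e g)) (proj₁ local) , subst (_≤ 2) (sym (outDeg-inner o' e g)) (proj₂ local)
      where
      local : inIn (arcsAt o' e) g ≤ 1 × outIn (arcsAt o' e) g ≤ 2
      local = proj₁ (proj₂ (goodInner e g)) (notOut ∘ isOut⇒outvertex e g)

    outvertexIn : ∀ X → Outvertex G X → inDeg G o' X ≡ 0
    outvertexIn _ (e , refl) = trans (inDeg-inner o' e gout) (proj₁ (proj₂ (proj₂ (goodInner e gout))) tt)

    degree3 : ∀ X → degH G X ≡ 3 → oppDeg G c' X ≡ 1 × inDeg G o' X ≡ 1 × outDeg G o' X ≡ 1
    degree3 (inj₁ v) _ = trans (oppSame v) (oppDeg≡1 v) , trans (inSame v) (inDeg≡1 v) ,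
                         trans (outSame v) (outDeg≡1 v)
    degree3 (inj₂ (e , g)) deg =
      trans (oppDeg-inner c' e g) (proj₁ local) , trans (inDeg-inner o' e g) (proj₁ (proj₂ local)) ,
      trans (outDeg-inner o' e g) (proj₂ (proj₂ local))
      where
      local : oppIn (repairedAt e) g ≡ 1 × inIn (arcsAt o' e) g ≡ 1 × outIn (arcsAt o' e) g ≡ 1
      local = proj₂ (proj₂ (proj₂ (goodInner e g))) (trans (sym (degH-inner e g)) deg)

    good : GoodColouredOrientation G c' o'
    good = record
      { coloured = record
        { atMostOneOpposite = atMostOne
        ; orientedIfMono    = proj₁ ∘ consistent'
        ; monoIfOriented    = proj₂ ∘ consistent'
        ; outBound          = λ X notOut → proj₂ (bounds X notOut)
        ; inBound           = λ X notOut → proj₁ (bounds X notOut)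
        ; outvertexIn       = outvertexIn
        }
      ; deg3 = degree3
      }

lemma11 : (G : Graph) → Simple G → Cubic G → Planar G
        → (∃₂ λ c o → ColouredOrientation G c o)
        → ∃₂ λ c o → GoodColouredOrientation G c o
lemma11 G simple cubic _ (c , o , co) =
  Repair.c' G c o balanced , Repair.o' G c o balanced , Repair.good G c o balanced oppDeg≡1 inDeg≡1 outDeg≡1
  where open Counting G simple cubic c o co
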